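{- For all integers $n \geq 0$, \[ P(n) \leq f(n) + Q(g(n)) \qquad\text{and}\qquad Q(n) \leq 1 + f(n) + P(g(n)). \]
   Context: For $A \subseteq \{0,1,2,\ldots\}$, $\partial A = \{z \in A : \{z-1,z+1\} \not\subseteq A\}$, $vol(A)=\sum_{z\in A} z$, $per(A) = \sum_{z \in \partial A} z$ (both $0$ for the empty set), and $A^c = \{0,1,2,\ldots\}\setminus A$. For integers $n\ge 0$, $P(n) = \min\{per(A) : A \subseteq \{0,1,\ldots\},\ vol(A)=n\}$ and $Q(n) = \min\{per(A^c) : A \subseteq \{0,1,\ldots\},\ vol(A) = n\}$. Also $f(n) = \lceil (-1+\sqrt{1+8n})/2 \rceil$ and $g(n) = f(n)(f(n)+1)/2 - n$. -}

module Defs where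

open import Data.Nat using (ℕ; zero; suc; _+_; _*_; _∸_; _≤_; _<_; _≤ᵇ_)
open import Data.Bool using (Bool; true; false; if_then_else_; _∧_; not)
open import Data.Product using (Σ; _×_; ∃)
open import Relation.Binary.PropositionalEquality using (_≡_)

-- A finite subset A of {0,1,2,...}: a membership predicate that is false
-- beyond some bound.  (Any A with vol(A) = n is finite, A ⊆ {0,…,n}.)
record FinSet : Set where
  field
    mem    : ℕ → Bool
    bound  : ℕ
    beyond : ∀ z → bound < z → mem z ≡ false
open FinSet public

sumTo : ℕ → (ℕ → ℕ) → ℕ
sumTo zero    h = h zero
sumTo (suc N) h = h (suc N) + sumTo N h

-- membership of z-1 (false for z = 0, since -1 ∉ {0,1,2,...})
memPred : (ℕ → Bool) → ℕ → Bool
memPred S zero    = false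
memPred S (suc z) = S z

inBoundary : (ℕ → Bool) → ℕ → Bool
inBoundary S z = S z ∧ not (memPred S z ∧ S (suc z))

perUpTo : (ℕ → Bool) → ℕ → ℕ
perUpTo S N = sumTo N (λ z → if inBoundary S z then z else 0)

vol : FinSet → ℕ
vol A = sumTo (bound A) (λ z → if mem A z then z else 0)

-- per(A): all boundary points of A lie in {0,…,bound A}
per : FinSet → ℕ
per A = perUpTo (mem A) (suc (bound A))

-- per(A^c), A^c = ℕ \ A: all boundary points of A^c lie in {0,…,bound A + 1}
perCompl : FinSet → ℕ
perCompl A = perUpTo (λ z → not (mem A z)) (suc (bound A))

-- "p = P(n)": p is the minimum of per(A) over A with vol(A) = n
IsP : ℕ → ℕ → Set
IsP n p = (Σ FinSet λ A → vol A ≡ n × per A ≡ p)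
        × (∀ (A : FinSet) → vol A ≡ n → p ≤ per A)

-- "q = Q(n)": q is the minimum of per(A^c) over A with vol(A) = n
IsQ : ℕ → ℕ → Set
IsQ n q = (Σ FinSet λ A → vol A ≡ n × perCompl A ≡ q)
        × (∀ (A : FinSet) → vol A ≡ n → q ≤ perCompl A)

tri : ℕ → ℕ
tri zero    = zero
tri (suc k) = suc k + tri k

-- f(n) = ⌈(-1+√(1+8n))/2⌉ = least k with n ≤ k(k+1)/2
search : ℕ → ℕ → ℕ → ℕ
search n k zero       = k
search n k (suc fuel) = if n ≤ᵇ tri k then k else search n (suc k) fuel

f : ℕ → ℕ
f n = search n 0 n

g : ℕ → ℕ
g n = tri (f n) ∸ n

module Submission where

-- Let k = f(n), the least k with n ≤ T(k) = k(k+1)/2, so that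
-- g(n) = T(k) - n ≤ k.  Take any B realising the optimum on the other side
-- (vol B = g(n)).  Every element of B is at most vol B ≤ k, so the set
--   A = {0,…,k} \ B
-- has vol A = T(k) - vol B = n.  Below k the set A agrees with B^c (and A^c
-- with B), so the boundaries can differ only near k:
--   * ∂A ⊆ ∂(B^c) ∪ {k},            hence per(A)   ≤ per(B^c) + k;
--   * ∂(A^c) ⊆ ∂B ∪ {k+1},          hence per(A^c) ≤ per(B)   + k + 1.
-- Minimality of P(n) resp. Q(n) then gives both inequalities.

open import Defs
open import Data.Nat using (ℕ; zero; suc; _+_; _∸_; _≤_; _<_; _≤ᵇ_; z≤n; s≤s)
open import Data.Nat.Properties
open import Data.Bool using (Bool; true; false; if_then_else_; _∧_; not; T)
open import Data.Bool.Properties using (not-involutive; T-≡)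
open import Data.Product using (_×_; _,_; proj₁; proj₂)
open import Data.Sum using (inj₁; inj₂)
open import Function using (_∘_)
open import Function.Bundles using (Equivalence)
open import Relation.Binary.PropositionalEquality
open import Relation.Binary.Definitions using (tri<; tri≈; tri>)
open import Relation.Nullary using (yes; no; contradiction)

open Equivalence using (to; from)

Vanishes : (ℕ → ℕ) → ℕ → Set
Vanishes h N = ∀ z → N < z → h z ≡ 0

sumTo-stable : ∀ {h N M} → Vanishes h N → N ≤ M → sumTo M h ≡ sumTo N h
sumTo-stable {M = zero}  van z≤n = refl
sumTo-stable {h} {M = suc M} van N≤1+M with m≤n⇒m<n∨m≡n N≤1+M
... | inj₂ refl = refl
... | inj₁ (s≤s N≤M) rewrite van (suc M) (s≤s N≤M) = sumTo-stable van N≤M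

sumTo-cutoff : ∀ {h N N'} → Vanishes h N → Vanishes h N' → sumTo N h ≡ sumTo N' h
sumTo-cutoff {N = N} {N'} van van' with ≤-total N N'
... | inj₁ N≤N' = sym (sumTo-stable van N≤N')
... | inj₂ N'≤N = sumTo-stable van' N'≤N

sumTo-cong : ∀ N {h h'} → (∀ z → z ≤ N → h z ≡ h' z) → sumTo N h ≡ sumTo N h'
sumTo-cong zero    eq = eq 0 z≤n
sumTo-cong (suc N) eq =
  cong₂ _+_ (eq (suc N) ≤-refl) (sumTo-cong N (λ z z≤N → eq z (m≤n⇒m≤1+n z≤N)))

sumTo-mono : ∀ N {h h'} → (∀ z → z ≤ N → h z ≤ h' z) → sumTo N h ≤ sumTo N h'
sumTo-mono zero    le = le 0 z≤n
sumTo-mono (suc N) le =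
  +-mono-≤ (le (suc N) ≤-refl) (sumTo-mono N (λ z z≤N → le z (m≤n⇒m≤1+n z≤N)))

sumTo-+ : ∀ N (h h' : ℕ → ℕ) → sumTo N (λ z → h z + h' z) ≡ sumTo N h + sumTo N h'
sumTo-+ zero    h h' = refl
sumTo-+ (suc N) h h' = begin
  (h (suc N) + h' (suc N)) + sumTo N (λ z → h z + h' z)
    ≡⟨ cong ((h (suc N) + h' (suc N)) +_) (sumTo-+ N h h') ⟩
  (h (suc N) + h' (suc N)) + (sumTo N h + sumTo N h')
    ≡⟨ +-assoc (h (suc N)) (h' (suc N)) _ ⟩
  h (suc N) + (h' (suc N) + (sumTo N h + sumTo N h'))
    ≡⟨ cong (h (suc N) +_) (x+[y+z]≡y+[x+z] (h' (suc N)) (sumTo N h) (sumTo N h')) ⟩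
  h (suc N) + (sumTo N h + (h' (suc N) + sumTo N h'))
    ≡⟨ +-assoc (h (suc N)) (sumTo N h) _ ⟨
  (h (suc N) + sumTo N h) + (h' (suc N) + sumTo N h') ∎
  where
  open ≡-Reasoning
  x+[y+z]≡y+[x+z] : ∀ x y z → x + (y + z) ≡ y + (x + z)
  x+[y+z]≡y+[x+z] x y z =
    trans (sym (+-assoc x y z)) (trans (cong (_+ z) (+-comm x y)) (+-assoc y x z))

sumTo-id : ∀ N → sumTo N (λ z → z) ≡ tri N
sumTo-id zero    = refl
sumTo-id (suc N) = cong (suc N +_) (sumTo-id N)

term-≤-sumTo : ∀ N h {z} → z ≤ N → h z ≤ sumTo N h
term-≤-sumTo zero    h z≤n = ≤-refl
term-≤-sumTo (suc N) h z≤1+N with m≤n⇒m<n∨m≡n z≤1+N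
... | inj₂ refl      = m≤m+n (h (suc N)) (sumTo N h)
... | inj₁ (s≤s z≤N) = ≤-trans (term-≤-sumTo N h z≤N) (m≤n+m (sumTo N h) (h (suc N)))

-- If h ≤ h' everywhere except at one point c, where h c ≤ c, then
-- Σ h ≤ Σ h' + c.  This is the form in which a boundary can gain one point.
sumTo-≤-except : ∀ N {h h'} c → (∀ z → z ≢ c → h z ≤ h' z) → h c ≤ c →
                 sumTo N h ≤ sumTo N h' + c
sumTo-≤-except zero {h} {h'} c le hc with 0 ≟ c
... | yes refl = ≤-trans hc (m≤n+m 0 (h' 0))
... | no  0≢c  = ≤-trans (le 0 0≢c) (m≤m+n (h' 0) c)
sumTo-≤-except (suc N) {h} {h'} c le hc with suc N ≟ c
... | yes refl = begin
  h (suc N) + sumTo N h          ≤⟨ +-mono-≤ hc (sumTo-mono N below) ⟩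
  suc N + sumTo N h'             ≤⟨ +-monoˡ-≤ (sumTo N h') (m≤n+m (suc N) (h' (suc N))) ⟩
  h' (suc N) + suc N + sumTo N h' ≡⟨ +-assoc (h' (suc N)) (suc N) _ ⟩
  h' (suc N) + (suc N + sumTo N h') ≡⟨ cong (h' (suc N) +_) (+-comm (suc N) _) ⟩
  h' (suc N) + (sumTo N h' + suc N) ≡⟨ +-assoc (h' (suc N)) _ (suc N) ⟨
  h' (suc N) + sumTo N h' + suc N ∎
  where
  open ≤-Reasoning
  below : ∀ z → z ≤ N → h z ≤ h' z
  below z z≤N = le z (λ { refl → <-irrefl refl (s≤s z≤N) })
... | no  1+N≢c = begin
  h (suc N) + sumTo N h           ≤⟨ +-mono-≤ (le (suc N) 1+N≢c) (sumTo-≤-except N c le hc) ⟩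
  h' (suc N) + (sumTo N h' + c)   ≡⟨ +-assoc (h' (suc N)) _ c ⟨
  h' (suc N) + sumTo N h' + c ∎
  where open ≤-Reasoning

sumTo-≤-except′ : ∀ {h h' N N'} c → Vanishes h N → Vanishes h' N' →
                  (∀ z → z ≢ c → h z ≤ h' z) → h c ≤ c →
                  sumTo N h ≤ sumTo N' h' + c
sumTo-≤-except′ {h} {h'} {N} {N'} c van van' le hc = begin
  sumTo N h                ≡⟨ sumTo-stable van (m≤m+n N N') ⟨
  sumTo (N + N') h         ≤⟨ sumTo-≤-except (N + N') c le hc ⟩
  sumTo (N + N') h' + c    ≡⟨ cong (_+ c) (sumTo-stable van' (m≤n+m N' N)) ⟩
  sumTo N' h' + c ∎
  where open ≤-Reasoning

cell : Bool → Bool → Bool → ℕ → ℕ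
cell l x r z = if x ∧ not (l ∧ r) then z else 0

∂term : (ℕ → Bool) → ℕ → ℕ
∂term S z = cell (memPred S z) (S z) (S (suc z)) z

cell-cong : ∀ {l l' x x' r r'} z → l ≡ l' → x ≡ x' → r ≡ r' → cell l x r z ≡ cell l' x' r' z
cell-cong z refl refl refl = refl

cell-≤ : ∀ l x r z → cell l x r z ≤ z
cell-≤ l x r z with x ∧ not (l ∧ r)
... | true  = ≤-refl
... | false = z≤n

∂term-≤ : ∀ S z → ∂term S z ≤ z
∂term-≤ S z = cell-≤ (memPred S z) (S z) (S (suc z)) z

∂term-absent : ∀ S z → S z ≡ false → ∂term S z ≡ 0
∂term-absent S z Sz = cong (λ x → cell (memPred S z) x (S (suc z)) z) Sz

∂term-interior : ∀ S y → S y ≡ true → S (suc y) ≡ true → S (suc (suc y)) ≡ true →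
                 ∂term S (suc y) ≡ 0
∂term-interior S y l x r = cell-cong (suc y) l x r

memPred-agree : ∀ {S S' k} → (∀ y → y ≤ k → S y ≡ S' y) →
                ∀ z → z ≤ k → memPred S z ≡ memPred S' z
memPred-agree agree zero    _   = refl
memPred-agree agree (suc y) y<k = agree y (<⇒≤ y<k)

∂term-agree : ∀ {S S' k} → (∀ y → y ≤ k → S y ≡ S' y) →
              ∀ z → z < k → ∂term S z ≡ ∂term S' z
∂term-agree agree z z<k =
  cell-cong z (memPred-agree agree z (<⇒≤ z<k)) (agree z (<⇒≤ z<k)) (agree (suc z) z<k)

∂term-right-full : ∀ S S' z → memPred S z ≡ memPred S' z → S z ≡ S' z →
                   S (suc z) ≡ true → ∂term S z ≤ ∂term S' z
∂term-right-full S S' z l x r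
  rewrite cell-cong {r' = true} z l x r
  with memPred S' z | S' z | S' (suc z)
... | true  | true  | _ = z≤n
... | false | true  | _ = ≤-refl
... | _     | false | _ = z≤n

∂term-vanishes-finite : ∀ S N → (∀ z → N < z → S z ≡ false) → Vanishes (∂term S) (suc N)
∂term-vanishes-finite S N empty z 1+N<z = ∂term-absent S z (empty z (<-trans (n<1+n N) 1+N<z))

∂term-vanishes-cofinite : ∀ S N → (∀ z → N < z → S z ≡ true) → Vanishes (∂term S) (suc N)
∂term-vanishes-cofinite S N full (suc y) (s≤s N<y) =
  ∂term-interior S y (full y N<y) (full (suc y) (m<n⇒m<1+n N<y))
                     (full (suc (suc y)) (m<n⇒m<1+n (m<n⇒m<1+n N<y)))

∂term-FinSet : ∀ B → Vanishes (∂term (mem B)) (suc (bound B))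
∂term-FinSet B = ∂term-vanishes-finite (mem B) (bound B) (beyond B)

∂term-FinSet-compl : ∀ B → Vanishes (∂term (λ z → not (mem B z))) (suc (bound B))
∂term-FinSet-compl B =
  ∂term-vanishes-cofinite (λ z → not (mem B z)) (bound B) (λ z p → cong not (beyond B z p))

volTerm : (ℕ → Bool) → ℕ → ℕ
volTerm S z = if S z then z else 0

member-≤-vol : ∀ B z → mem B z ≡ true → z ≤ vol B
member-≤-vol B z Bz with z ≤? bound B
... | yes z≤bound = subst (_≤ vol B) value (term-≤-sumTo (bound B) (volTerm (mem B)) z≤bound)
  where
  value : volTerm (mem B) z ≡ z
  value rewrite Bz = refl
... | no z≰bound with trans (sym Bz) (beyond B z (≰⇒> z≰bound))
... | ()

vol-cutoff : ∀ B k → vol B ≤ k → sumTo k (volTerm (mem B)) ≡ vol B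
vol-cutoff B k volB≤k = sumTo-cutoff aboveK aboveBound
  where
  aboveK : Vanishes (volTerm (mem B)) k
  aboveK z k<z with mem B z in Bz
  ... | false = refl
  ... | true  = contradiction (≤-trans (member-≤-vol B z Bz) volB≤k) (<⇒≱ k<z)
  aboveBound : Vanishes (volTerm (mem B)) (bound B)
  aboveBound z p rewrite beyond B z p = refl

volTerm-split : ∀ S z → volTerm (λ y → not (S y)) z + volTerm S z ≡ z
volTerm-split S z with S z
... | true  = refl
... | false = +-identityʳ z

search-spec : ∀ n fuel k → n ≤ tri (k + fuel) → (∀ j → j < k → tri j < n) →
              n ≤ tri (search n k fuel) × (∀ j → j < search n k fuel → tri j < n)
search-spec n zero       k n≤T below = subst (λ m → n ≤ tri m) (+-identityʳ k) n≤T , below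
search-spec n (suc fuel) k n≤T below with n ≤ᵇ tri k in stop
... | true  = ≤ᵇ⇒≤ n (tri k) (from T-≡ stop) , below
... | false = search-spec n fuel (suc k) (subst (λ m → n ≤ tri m) (+-suc k fuel) n≤T) below′
  where
  Tk<n : tri k < n
  Tk<n = ≰⇒> (λ n≤Tk → subst T stop (≤⇒≤ᵇ n≤Tk))
  below′ : ∀ j → j < suc k → tri j < n
  below′ j (s≤s j≤k) with m≤n⇒m<n∨m≡n j≤k
  ... | inj₁ j<k  = below j j<k
  ... | inj₂ refl = Tk<n

f-spec : ∀ n → n ≤ tri (f n) × (∀ j → j < f n → tri j < n)
f-spec n = search-spec n n 0 (n≤tri n) (λ j ())
  where
  n≤tri : ∀ m → m ≤ tri m
  n≤tri zero    = z≤n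
  n≤tri (suc m) = m≤m+n (suc m) (tri m)

tri∸-≤ : ∀ n k → (∀ j → j < k → tri j < n) → tri k ∸ n ≤ k
tri∸-≤ n zero    below = ≤-reflexive (0∸n≡0 n)
tri∸-≤ n (suc j) below = begin
  suc j + tri j ∸ n        ≤⟨ ∸-monoʳ-≤ (suc j + tri j) (below j ≤-refl) ⟩
  suc j + tri j ∸ suc (tri j) ≡⟨ cong (_∸ suc (tri j)) (+-suc j (tri j)) ⟨
  j + suc (tri j) ∸ suc (tri j) ≡⟨ m+n∸n≡m j (suc (tri j)) ⟩
  j                        ≤⟨ n≤1+n j ⟩
  suc j ∎
  where open ≤-Reasoning

g≤f : ∀ n → g n ≤ f n
g≤f n = tri∸-≤ n (f n) (proj₂ (f-spec n))

module Truncated (k : ℕ) (B : FinSet) where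

  b : ℕ → Bool
  b = mem B

  a : ℕ → Bool
  a z = (z ≤ᵇ k) ∧ not (b z)

  a-below : ∀ z → z ≤ k → a z ≡ not (b z)
  a-below z z≤k = cong (_∧ not (b z)) (to T-≡ (≤⇒≤ᵇ z≤k))

  a-above : ∀ z → k < z → a z ≡ false
  a-above z k<z with z ≤ᵇ k in le
  ... | false = refl
  ... | true  = contradiction (≤ᵇ⇒≤ z k (from T-≡ le)) (<⇒≱ k<z)

  ac : ℕ → Bool
  ac z = not (a z)

  ac-below : ∀ z → z ≤ k → ac z ≡ b z
  ac-below z z≤k = trans (cong not (a-below z z≤k)) (not-involutive (b z))

  ac-above : ∀ z → k < z → ac z ≡ true
  ac-above z k<z = cong not (a-above z k<z)

  A : FinSet
  A = record { mem = a ; bound = k ; beyond = a-above }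

  -- vol A + vol B = T(k) as soon as B ⊆ {0,…,k}, which vol B ≤ k guarantees.
  vol-A : vol B ≤ k → vol A + vol B ≡ tri k
  vol-A volB≤k = begin
    vol A + vol B                                    ≡⟨ cong (vol A +_) (vol-cutoff B k volB≤k) ⟨
    sumTo k (volTerm a) + sumTo k (volTerm b)        ≡⟨ sumTo-+ k (volTerm a) (volTerm b) ⟨
    sumTo k (λ z → volTerm a z + volTerm b z)        ≡⟨ sumTo-cong k split ⟩
    sumTo k (λ z → z)                                ≡⟨ sumTo-id k ⟩
    tri k ∎
    where
    open ≡-Reasoning
    split : ∀ z → z ≤ k → volTerm a z + volTerm b z ≡ z
    split z z≤k = trans (cong (λ x → (if x then z else 0) + volTerm b z) (a-below z z≤k))
                        (volTerm-split b z)

  -- ∂A ⊆ ∂(B^c) ∪ {k}.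
  per-A : per A ≤ perCompl B + k
  per-A = sumTo-≤-except′ k (∂term-FinSet A) (∂term-FinSet-compl B) away (∂term-≤ a k)
    where
    away : ∀ z → z ≢ k → ∂term a z ≤ ∂term (λ y → not (b y)) z
    away z z≢k with <-cmp z k
    ... | tri< z<k _ _ = ≤-reflexive (∂term-agree a-below z z<k)
    ... | tri≈ _ z≡k _ = contradiction z≡k z≢k
    ... | tri> _ _ k<z = ≤-trans (≤-reflexive (∂term-absent a z (a-above z k<z))) z≤n

  -- ∂(A^c) ⊆ ∂B ∪ {k+1}.
  perCompl-A : perCompl A ≤ per B + suc k
  perCompl-A = sumTo-≤-except′ (suc k) ac-vanishes (∂term-FinSet B) away (∂term-≤ ac (suc k))
    where
    ac-vanishes : Vanishes (∂term ac) (suc k)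
    ac-vanishes = ∂term-vanishes-cofinite ac k ac-above
    away : ∀ z → z ≢ suc k → ∂term ac z ≤ ∂term b z
    away z z≢1+k with <-cmp z k
    ... | tri< z<k _ _ = ≤-reflexive (∂term-agree ac-below z z<k)
    ... | tri≈ _ refl _ =
      ∂term-right-full ac b k (memPred-agree ac-below k ≤-refl) (ac-below k ≤-refl)
                       (ac-above (suc k) ≤-refl)
    ... | tri> _ _ k<z = ≤-trans (≤-reflexive (ac-vanishes z (≤∧≢⇒< k<z (z≢1+k ∘ sym)))) z≤n

theorem10 : (n : ℕ) →
    (∀ p q → IsP n p → IsQ (g n) q → p ≤ f n + q) ×
    (∀ q p → IsQ n q → IsP (g n) p → q ≤ 1 + f n + p)
theorem10 n = P-bound , Q-bound
  where
  open Truncated (f n) using (A; vol-A; per-A; perCompl-A)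

  vol-n : ∀ B → vol B ≡ g n → vol (A B) ≡ n
  vol-n B volB = +-cancelʳ-≡ (vol B) (vol (A B)) n (begin
    vol (A B) + vol B   ≡⟨ vol-A B (subst (_≤ f n) (sym volB) (g≤f n)) ⟩
    tri (f n)           ≡⟨ m+[n∸m]≡n (proj₁ (f-spec n)) ⟨
    n + g n             ≡⟨ cong (n +_) volB ⟨
    n + vol B ∎)
    where open ≡-Reasoning

  P-bound : ∀ p q → IsP n p → IsQ (g n) q → p ≤ f n + q
  P-bound p q (_ , P-min) ((B , volB , perB) , _) = begin
    p                   ≤⟨ P-min (A B) (vol-n B volB) ⟩
    per (A B)           ≤⟨ per-A B ⟩
    perCompl B + f n    ≡⟨ cong (_+ f n) perB ⟩
    q + f n             ≡⟨ +-comm q (f n) ⟩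
    f n + q ∎
    where open ≤-Reasoning

  Q-bound : ∀ q p → IsQ n q → IsP (g n) p → q ≤ 1 + f n + p
  Q-bound q p (_ , Q-min) ((B , volB , perB) , _) = begin
    q                   ≤⟨ Q-min (A B) (vol-n B volB) ⟩
    perCompl (A B)      ≤⟨ perCompl-A B ⟩
    per B + suc (f n)   ≡⟨ cong (_+ suc (f n)) perB ⟩
    p + suc (f n)       ≡⟨ +-comm p (suc (f n)) ⟩
    1 + f n + p ∎
    where open ≤-Reasoning
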